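{- Let $n\in\mathbb{N}$. If $\beta=(b_1,\dots,b_n)\in PF_{n,n-1}^*$, then $b_n=n$.
   Context: For integers $k\geq 0$, a $k$-Naples parking function of length $n$ is a tuple $(b_1,\dots,b_n)\in\{1,\dots,n\}^n$ such that, when cars $c_1,\dots,c_n$ arrive in order at spots $1,\dots,n$ (west to east) with car $c_i$ preferring $b_i$, all cars park under the following rule: $c_i$ parks at $b_i$ if it is empty; otherwise it checks the spots $b_i-1,\dots,b_i-k$ lying in $\{1,\dots,n\}$, one at a time in this order, and parks in the first empty one; if all are occupied it parks in the first empty spot among $b_i+1,\dots,n$, failing if none. $PF_{n,k}$ is the set of these, and $PF_{n,k}^*=PF_{n,k}\setminus PF_{n,k-1}$ for $k\geq1$, with $PF_{n,0}^*=\emptyset$. Note $PF_{n,n-1}=\{1,\dots,n\}^n$. -}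

module Defs where

open import Data.Nat using (ℕ; zero; suc; _∸_; _≤_; _≤ᵇ_; _≡ᵇ_)
open import Data.Bool using (Bool; true; false; if_then_else_)
open import Data.List using (List; []; _∷_)
open import Data.Bool.ListAction using (any)
open import Data.Maybe using (Maybe; just; nothing)
open import Data.Maybe.Relation.Unary.Any using () renaming (Any to MaybeAny)
open import Data.Vec using (Vec; toList)
open import Data.Vec.Relation.Unary.All using (All)
open import Data.Product using (_×_)
open import Data.Unit using (⊤)
open import Data.Empty using (⊥)
open import Relation.Nullary using (¬_)

-- Spots are the naturals 1..n; a set of occupied spots is a list.
occupied : ℕ → List ℕ → Bool
occupied p S = any (λ x → x ≡ᵇ p) S

backward : ℕ → ℕ → List ℕ → Maybe ℕ
backward zero    b S = nothing
backward (suc k) b S =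
  if b ≤ᵇ 1 then nothing
  else (if occupied (b ∸ 1) S then backward k (b ∸ 1) S else just (b ∸ 1))

forward : ℕ → ℕ → List ℕ → Maybe ℕ
forward zero    p S = nothing
forward (suc f) p S =
  if occupied (suc p) S then forward f (suc p) S else just (suc p)

-- Where a car with preference b parks under the k-Naples rule, given
-- occupied spots S, with n spots in total (nothing = fails to park).
parkOne : (n k b : ℕ) → List ℕ → Maybe ℕ
parkOne n k b S with occupied b S
... | false = just b
... | true with backward k b S
...   | just p  = just p
...   | nothing = forward (n ∸ b) b S

parkAll : (n k : ℕ) → List ℕ → List ℕ → Maybe (List ℕ)
parkAll n k []       S = just S
parkAll n k (b ∷ bs) S with parkOne n k b S
... | nothing = nothing
... | just p  = parkAll n k bs (p ∷ S)

InRange : (n : ℕ) → ℕ → Set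
InRange n b = (1 ≤ b) × (b ≤ n)

NaplesPF : (n k : ℕ) → Vec ℕ n → Set
NaplesPF n k β = All (InRange n) β × MaybeAny (λ _ → ⊤) (parkAll n k (toList β) [])

NaplesPF* : (n k : ℕ) → Vec ℕ n → Set
NaplesPF* n zero    β = ⊥
NaplesPF* n (suc k) β = NaplesPF n (suc k) β × ¬ NaplesPF n k β

module Submission where

-- Under the (n-2)-Naples rule on n = m + 2 spots, a car that cannot park
-- sees, by exhausting its backward search (k = n-2 spots) and its forward
-- search, that every spot p with b ≤ p + k is occupied; this means all of the
-- spots 2,…,n, and all of 1,…,n if its preference b is below n.  Hence when a
-- car fails at least n-1 cars have parked before it, so it is the last car;
-- and since only n-1 spots are taken, its preference must be b = n.

open import Defs
open import Data.Nat using (ℕ; suc; _∸_)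
open import Data.Vec using (Vec; last)
open import Relation.Binary.PropositionalEquality using (_≡_)

open import Data.Nat using (zero; _+_; _≤_; _<_; z≤n; s≤s)
open import Data.Nat.Properties
open import Data.Bool using (true; false)
open import Data.Bool.Properties using (T-≡)
open import Data.List using (List; []; _∷_; length)
open import Data.List.Membership.Propositional using (_∈_)
open import Data.List.Relation.Unary.Any using (here; there)
import Data.List.Relation.Unary.Any as Any
open import Data.List.Relation.Unary.Any.Properties using (any⁻)
open import Data.Vec using ([]; _∷_; toList)
open import Data.Vec.Relation.Unary.All using (All; _∷_)
open import Data.Maybe using (just; nothing)
open import Data.Maybe.Relation.Unary.Any using () renaming (just to isJust)
open import Data.Product using (_×_; _,_; Σ)
open import Data.Sum using (inj₁; inj₂)
open import Data.Unit using (tt)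
open import Data.Empty using (⊥-elim)
open import Function.Bundles using (Equivalence)
open import Relation.Binary.Definitions using (tri<; tri≈; tri>)
open import Relation.Nullary using (¬_)
open import Relation.Binary.PropositionalEquality using (_≢_; refl; sym; trans; cong; subst)

occupied⇒∈ : ∀ p S → occupied p S ≡ true → p ∈ S
occupied⇒∈ p S occ =
  Any.map (λ x≡ᵇp → sym (≡ᵇ⇒≡ _ p x≡ᵇp))
          (any⁻ _ S (Equivalence.from T-≡ occ))

delete : ∀ {A : Set} {x : A} {xs} → x ∈ xs →
         Σ (List A) λ ys → length xs ≡ suc (length ys) × (∀ {y} → y ∈ xs → y ≢ x → y ∈ ys)
delete {xs = _ ∷ xs} (here refl) = xs , refl , keep
  where
  keep : ∀ {y} → y ∈ _ ∷ xs → y ≢ _ → y ∈ xs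
  keep (here refl) y≢x = ⊥-elim (y≢x refl)
  keep (there y∈xs) _  = y∈xs
delete {xs = z ∷ xs} (there x∈xs) with delete x∈xs
... | ys , len , keep = z ∷ ys , cong suc len , keep′
  where
  keep′ : ∀ {y} → y ∈ z ∷ xs → y ≢ _ → y ∈ z ∷ ys
  keep′ (here refl)  _   = here refl
  keep′ (there y∈xs) y≢x = there (keep y∈xs y≢x)

interval⇒≤length : ∀ j c xs → (∀ i → i < j → c + i ∈ xs) → j ≤ length xs
interval⇒≤length zero    c xs members = z≤n
interval⇒≤length (suc j) c xs members
  with delete (subst (_∈ xs) (+-identityʳ c) (members 0 (s≤s z≤n)))
... | ys , len , keep =
  subst (suc j ≤_) (sym len) (s≤s (interval⇒≤length j (suc c) ys members′))
  where
  members′ : ∀ i → i < j → suc c + i ∈ ys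
  members′ i i<j =
    keep (subst (_∈ xs) (+-suc c i) (members (suc i) (s≤s i<j)))
         (λ eq → m+1+n≢m c (trans (+-suc c i) eq))

backward-exhausted : ∀ k b S → backward k b S ≡ nothing →
                     ∀ p → 1 ≤ p → p < b → b ≤ p + k → p ∈ S
backward-exhausted zero b S _ p _ p<b b≤p+0 =
  ⊥-elim (<⇒≱ p<b (subst (b ≤_) (+-identityʳ p) b≤p+0))
backward-exhausted (suc k) (suc zero) S _ p (s≤s z≤n) (s≤s ()) _
backward-exhausted (suc k) (suc (suc c)) S fail p 1≤p p<b b≤p+k
  with occupied (suc c) S in occ
... | true with m≤n⇒m<n∨m≡n (≤-pred p<b)
...   | inj₂ refl = occupied⇒∈ p S occ
...   | inj₁ p<c  = backward-exhausted k (suc c) S fail p 1≤p p<c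
                      (≤-pred (subst (suc (suc c) ≤_) (+-suc p k) b≤p+k))
backward-exhausted (suc k) (suc (suc c)) S () p 1≤p p<b b≤p+k | false

forward-exhausted : ∀ f p S → forward f p S ≡ nothing →
                    ∀ q → p < q → q ≤ p + f → q ∈ S
forward-exhausted zero p S _ q p<q q≤p+0 =
  ⊥-elim (<⇒≱ p<q (subst (q ≤_) (+-identityʳ p) q≤p+0))
forward-exhausted (suc f) p S fail q p<q q≤p+f with occupied (suc p) S in occ
... | true with m≤n⇒m<n∨m≡n p<q
...   | inj₂ refl = occupied⇒∈ q S occ
...   | inj₁ p+1<q = forward-exhausted f (suc p) S fail q p+1<q
                       (subst (q ≤_) (+-suc p f) q≤p+f)
forward-exhausted (suc f) p S () q p<q q≤p+f | false

parkOne-fails : ∀ n k b S → parkOne n k b S ≡ nothing →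
                b ∈ S × backward k b S ≡ nothing × forward (n ∸ b) b S ≡ nothing
parkOne-fails n k b S fail with occupied b S in occ
... | true with backward k b S
...   | nothing = occupied⇒∈ b S occ , refl , fail
parkOne-fails n k b S () | true | just _
parkOne-fails n k b S () | false

stuck⇒occupied : ∀ n k b S → b ≤ n → parkOne n k b S ≡ nothing →
                 ∀ p → 1 ≤ p → p ≤ n → b ≤ p + k → p ∈ S
stuck⇒occupied n k b S b≤n fail p 1≤p p≤n b≤p+k
  with parkOne-fails n k b S fail | <-cmp p b
... | b∈S , _ , _        | tri≈ _ refl _ = b∈S
... | _ , backFail , _   | tri< p<b _ _ = backward-exhausted k b S backFail p 1≤p p<b b≤p+k
... | _ , _ , forwFail   | tri> _ _ b<p =
  forward-exhausted (n ∸ b) b S forwFail p b<p (subst (p ≤_) (sym (m+[n∸m]≡n b≤n)) p≤n)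

-- With n = m + 2 spots and k = m: a stuck car sees spots 2, …, n occupied,
-- so at least n - 1 cars have already parked.
stuck⇒n-1≤parked : ∀ m b S → b ≤ suc (suc m) → parkOne (suc (suc m)) m b S ≡ nothing →
                   suc m ≤ length S
stuck⇒n-1≤parked m b S b≤n fail = interval⇒≤length (suc m) 2 S λ i i<m+1 →
  stuck⇒occupied (suc (suc m)) m b S b≤n fail (2 + i) (s≤s z≤n) (s≤s (s≤s (≤-pred i<m+1)))
    (≤-trans b≤n (+-monoˡ-≤ m (s≤s (s≤s z≤n))))

-- If moreover b < n, spot 1 is also in reach, so all n spots are occupied.
stuck-below⇒n≤parked : ∀ m b S → b < suc (suc m) → parkOne (suc (suc m)) m b S ≡ nothing →
                       suc (suc m) ≤ length S
stuck-below⇒n≤parked m b S b<n fail = interval⇒≤length (suc (suc m)) 1 S λ i i<n →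
  stuck⇒occupied (suc (suc m)) m b S (<⇒≤ b<n) fail (1 + i) (s≤s z≤n) i<n
    (≤-trans (≤-pred b<n) (+-monoˡ-≤ m (s≤s z≤n)))

-- Running the (n-2)-Naples process with one remaining car per free spot
-- (|S| + #cars = n): if some car fails, it is the last car and prefers n.
run-fails : ∀ m {j} (bs : Vec ℕ (suc j)) S → All (InRange (suc (suc m))) bs →
            length S + suc j ≡ suc (suc m) →
            parkAll (suc (suc m)) m (toList bs) S ≡ nothing → last bs ≡ suc (suc m)
run-fails m {j} (b ∷ bs) S ((_ , b≤n) ∷ inRange) count fail
  with parkOne (suc (suc m)) m b S in stuck
run-fails m {zero} (b ∷ []) S ((_ , b≤n) ∷ _) count _ | nothing
  with m≤n⇒m<n∨m≡n b≤n
... | inj₂ b≡n = b≡n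
... | inj₁ b<n = ⊥-elim (<⇒≱ (stuck-below⇒n≤parked m b S b<n stuck) S≤m+1)
  where
  S≤m+1 : length S ≤ suc m
  S≤m+1 = ≤-reflexive (+-cancelʳ-≡ _ _ _ (trans count (+-comm 1 (suc m))))
run-fails m {suc j} (b ∷ _) S ((_ , b≤n) ∷ _) count _ | nothing =
  ⊥-elim (<⇒≱ S<m+1 (stuck⇒n-1≤parked m b S b≤n stuck))
  where
  -- at least two cars remain, so at most n - 2 spots are taken
  count′ : suc (suc (length S + j)) ≡ suc (suc m)
  count′ = trans (sym (trans (+-suc (length S) (suc j)) (cong suc (+-suc (length S) j)))) count
  S<m+1 : length S < suc m
  S<m+1 = s≤s (≤-trans (m≤m+n (length S) j) (≤-reflexive (suc-injective (suc-injective count′))))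
run-fails m {zero} (b ∷ []) S _ _ () | just _
run-fails m {suc j} (b ∷ bs) S (_ ∷ inRange) count fail | just p =
  run-fails m bs (p ∷ S) inRange (trans (sym (+-suc (length S) (suc j))) count) fail

not-PF⇒fails : ∀ n k (β : Vec ℕ n) → All (InRange n) β → ¬ NaplesPF n k β →
               parkAll n k (toList β) [] ≡ nothing
not-PF⇒fails n k β inRange notPF with parkAll n k (toList β) []
... | just _  = ⊥-elim (notPF (inRange , isJust tt))
... | nothing = refl

lemma2p2 : (m : ℕ) (β : Vec ℕ (suc m)) → NaplesPF* (suc m) (suc m ∸ 1) β → last β ≡ suc m
lemma2p2 zero    β ()
lemma2p2 (suc m) β ((inRange , _) , notPF) =
  run-fails m β [] inRange refl (not-PF⇒fails (suc (suc m)) m β inRange notPF)
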